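{- Let $a$ be a binary word such that $a1$ is a canonical Tribonacci representation. Then the row of the Trithoff array whose first entry is $[a1]_T$ has row number \[[a1]_T-[a]_T=1+[a1]_U.\]
   Context: Tribonacci numbers: $T_0=0,T_1=0,T_2=1$, $T_n=T_{n-1}+T_{n-2}+T_{n-3}$ ($n\ge3$). For a word $w=d_k\cdots d_1d_0$ of nonnegative integer digits, $[w]_T=\sum_i d_iT_{i+3}$ (so digit positions from the right have weights $1,2,4,7,13,\dots$); the empty word evaluates to $0$. A canonical Tribonacci representation is such a word with digits in $\{0,1\}$ and no three consecutive $1$s; every nonnegative integer has a unique one. Define $U_i=T_{i+3}-T_{i+2}$ (so $U_0=0,U_1=1,U_2=2,U_3=3,U_4=6,\dots$) and $[d_k\cdots d_0]_U=\sum_i d_iU_i$. The Tribonacci successor is $\operatorname{out}([w]_T)=[w0]_T$ for canonical $w$. The Trithoff array has entries $T_{r,c}$ ($r,c\ge1$): $T_{r,1}$ is the $r$-th smallest positive integer whose canonical Tribonacci representation ends in $1$, and $T_{r,c+1}=\operatorname{out}(T_{r,c})$. Rows are numbered $1,2,3,\dots$ from the top. -}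

module Defs where

open import Data.Nat using (ℕ; zero; suc; _+_; _*_; _∸_; _≤_; _<_)
open import Data.List using (List; []; _∷_; _++_; reverse; length; [_])
open import Data.List.Relation.Unary.All using (All)
open import Data.List.Relation.Unary.Linked using (Linked)
open import Data.List.Membership.Propositional using (_∈_)
open import Data.Product using (Σ; _×_; ∃; ∃-syntax)
open import Data.Sum using (_⊎_)
open import Relation.Nullary using (¬_)
open import Relation.Binary.PropositionalEquality using (_≡_)
open import Function.Bundles using (_⇔_)

Trib : ℕ → ℕ
Trib 0 = 0
Trib 1 = 0
Trib 2 = 1
Trib (suc (suc (suc n))) = Trib (suc (suc n)) + Trib (suc n) + Trib n

Ucoef : ℕ → ℕ
Ucoef i = Trib (i + 3) ∸ Trib (i + 2)

-- A word d_k ⋯ d_1 d_0 is a list written left to right (most significant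
-- digit first, d_0 is the last element of the list).
Word : Set
Word = List ℕ

evalRev : (ℕ → ℕ) → ℕ → List ℕ → ℕ
evalRev f i [] = 0
evalRev f i (d ∷ ds) = d * f i + evalRev f (suc i) ds

evalT : Word → ℕ
evalT w = evalRev (λ i → Trib (i + 3)) 0 (reverse w)

evalU : Word → ℕ
evalU w = evalRev Ucoef 0 (reverse w)

Canonical : Word → Set
Canonical w = All (λ d → d ≡ 0 ⊎ d ≡ 1) w
            × (¬ (Σ Word λ u → Σ Word λ v → w ≡ u ++ (1 ∷ 1 ∷ 1 ∷ []) ++ v))

EndsIn1 : ℕ → Set
EndsIn1 n = Σ Word λ a → Canonical (a ++ [ 1 ]) × evalT (a ++ [ 1 ]) ≡ n

IsRthSmallest : (ℕ → Set) → ℕ → ℕ → Set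
IsRthSmallest P r n =
  P n × 1 ≤ n ×
  (Σ (List ℕ) λ xs → Linked _<_ xs × length xs ≡ r ×
     (∀ m → (m ∈ xs) ⇔ (1 ≤ m × m ≤ n × P m)))

TrithoffFirst : ℕ → ℕ → Set
TrithoffFirst r n = IsRthSmallest EndsIn1 r n

-- Fix a length k + 1.  Every n < T_{k+4} has a unique canonical representation v d of length k + 1,
-- found greedily.  If u e represents n + 1, then [u]_T = [v]_T when e = 1, and [u]_T = [v]_T + 1 when
-- e = 0, because a canonical w with [v] < [w] < [u] would give [v d] < [w 0] < [u 0].  So, by induction
-- on n, exactly n − [v]_T numbers m ∈ [1, n] have a representation ending in 1.  For k = |a| and
-- n = [a1]_T this count, the row number, is [a1]_T − [a]_T; and since U_0 = 0 and U_{i+1} + T_{i+3} = T_{i+4},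
-- [a1]_T = 1 + [a0]_T = 1 + [a1]_U + [a]_T.
module Submission where

open import Defs
open import Data.Nat using (ℕ; zero; suc; _+_; _*_; _∸_; _≤_; _<_; _≤′_; ≤′-refl; ≤′-step; z≤n; s≤s; _<?_)
open import Data.Nat.Properties
open import Data.List using (List; []; _∷_; _++_; [_]; _∷ʳ_; reverse; length; replicate; initLast; _∷ʳ′_)
open import Data.List.Properties
  using (reverse-++; unfold-reverse; length-reverse; length-++; length-replicate; ++-assoc; ∷ʳ-injectiveˡ; ∷ʳ-injectiveʳ)
open import Data.List.Relation.Unary.All as All using (All; []; _∷_)
open import Data.List.Relation.Unary.Any using (here)
open import Data.List.Relation.Unary.Linked using (Linked; []; [-]; _∷_)
open import Data.List.Relation.Unary.Linked.Properties using (Linked⇒AllPairs)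
import Data.List.Relation.Unary.AllPairs as AllPairs
open import Data.List.Relation.Unary.Unique.Propositional using (Unique)
open import Data.List.Membership.Propositional using (_∈_)
open import Data.List.Membership.Propositional.Properties using (∈-++⁺ˡ; ∈-++⁺ʳ; ∈-++⁻)
open import Data.List.Membership.Propositional.Properties.WithK using (unique∧set⇒bag)
open import Data.List.Relation.Binary.BagAndSetEquality using (∼bag⇒↭)
open import Data.List.Relation.Binary.Permutation.Propositional.Properties using (↭-length)
open import Data.Product using (Σ; ∃; _×_; _,_; proj₁; proj₂)
open import Data.Sum using (_⊎_; inj₁; inj₂)
open import Data.Empty using (⊥; ⊥-elim)
open import Relation.Nullary using (¬_; yes; no)
open import Relation.Binary using (tri<; tri≈; tri>)
open import Relation.Binary.PropositionalEquality
  using (_≡_; refl; sym; trans; cong; cong₂; subst; subst₂; module ≡-Reasoning)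
open import Function.Base using (_∘_)
open import Function.Bundles using (_⇔_; mk⇔; Equivalence)
import Function.Properties.Equivalence as ⇔
open import Algebra.Properties.CommutativeSemigroup +-commutativeSemigroup using (interchange)

weight : ℕ → ℕ
weight n = Trib (3 + n)

Trib-≤-suc : ∀ n → Trib n ≤ Trib (suc n)
Trib-≤-suc 0 = z≤n
Trib-≤-suc 1 = z≤n
Trib-≤-suc 2 = s≤s z≤n
Trib-≤-suc (suc (suc (suc n))) =
  ≤-trans (m≤m+n (Trib (3 + n)) (Trib (2 + n))) (m≤m+n _ (Trib (1 + n)))

weight-mono-≤ : ∀ {m n} → m ≤ n → weight m ≤ weight n
weight-mono-≤ m≤n = go (≤⇒≤′ m≤n)
  where
  go : ∀ {m n} → m ≤′ n → weight m ≤ weight n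
  go ≤′-refl = ≤-refl
  go (≤′-step {n} m≤′n) = ≤-trans (go m≤′n) (Trib-≤-suc (3 + n))

Ucoef-suc+Trib : ∀ i → Ucoef (suc i) + Trib (i + 3) ≡ Trib (suc i + 3)
Ucoef-suc+Trib i rewrite +-suc i 2 = m∸n+n≡m (Trib-≤-suc (suc (i + 2)))

evalRev-++ : ∀ f i xs ys → evalRev f i (xs ++ ys) ≡ evalRev f i xs + evalRev f (i + length xs) ys
evalRev-++ f i [] ys = cong (λ j → evalRev f j ys) (sym (+-identityʳ i))
evalRev-++ f i (x ∷ xs) ys rewrite evalRev-++ f (suc i) xs ys | +-suc i (length xs) =
  sym (+-assoc (x * f i) (evalRev f (suc i) xs) _)

evalRev-telescope : ∀ {f g : ℕ → ℕ} → (∀ j → f (suc j) + g j ≡ g (suc j)) →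
  ∀ i xs → evalRev f (suc i) xs + evalRev g i xs ≡ evalRev g (suc i) xs
evalRev-telescope step i [] = refl
evalRev-telescope {f} {g} step i (x ∷ xs) = begin
  (x * f (suc i) + evalRev f (suc (suc i)) xs) + (x * g i + evalRev g (suc i) xs)
    ≡⟨ interchange (x * f (suc i)) _ (x * g i) _ ⟩
  (x * f (suc i) + x * g i) + (evalRev f (suc (suc i)) xs + evalRev g (suc i) xs)
    ≡⟨ cong₂ _+_ (trans (sym (*-distribˡ-+ x _ _)) (cong (x *_) (step i))) (evalRev-telescope step (suc i) xs) ⟩
  x * g (suc i) + evalRev g (suc (suc i)) xs ∎
  where open ≡-Reasoning

evalT-∷ : ∀ d w → evalT (d ∷ w) ≡ d * weight (length w) + evalT w
evalT-∷ d w = begin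
  evalRev T 0 (reverse (d ∷ w))                 ≡⟨ cong (evalRev T 0) (unfold-reverse d w) ⟩
  evalRev T 0 (reverse w ∷ʳ d)                  ≡⟨ evalRev-++ T 0 (reverse w) [ d ] ⟩
  evalT w + (d * T (length (reverse w)) + 0)   ≡⟨ cong (λ n → evalT w + (d * Trib n + 0)) |w|+3≡3+|w| ⟩
  evalT w + (d * weight (length w) + 0)        ≡⟨ cong (evalT w +_) (+-identityʳ _) ⟩
  evalT w + d * weight (length w)              ≡⟨ +-comm (evalT w) _ ⟩
  d * weight (length w) + evalT w              ∎
  where
  open ≡-Reasoning
  T : ℕ → ℕ
  T i = Trib (i + 3)
  |w|+3≡3+|w| : length (reverse w) + 3 ≡ 3 + length w
  |w|+3≡3+|w| = trans (+-comm _ 3) (cong (3 +_) (length-reverse w))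

evalT-0∷ : ∀ w → evalT (0 ∷ w) ≡ evalT w
evalT-0∷ = evalT-∷ 0

evalT-1∷ : ∀ w → evalT (1 ∷ w) ≡ weight (length w) + evalT w
evalT-1∷ w = trans (evalT-∷ 1 w) (cong (_+ evalT w) (*-identityˡ _))

evalT-10∷ : ∀ w → evalT (1 ∷ 0 ∷ w) ≡ weight (suc (length w)) + evalT w
evalT-10∷ w = trans (evalT-1∷ (0 ∷ w)) (cong (weight (suc (length w)) +_) (evalT-0∷ w))

evalT-110∷ : ∀ w → evalT (1 ∷ 1 ∷ 0 ∷ w) ≡ weight (2 + length w) + weight (1 + length w) + evalT w
evalT-110∷ w = trans (evalT-1∷ (1 ∷ 0 ∷ w)) (trans (cong (weight (2 + length w) +_) (evalT-10∷ w))
  (sym (+-assoc (weight (2 + length w)) (weight (1 + length w)) (evalT w))))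

evalT-replicate0-++ : ∀ j w → evalT (replicate j 0 ++ w) ≡ evalT w
evalT-replicate0-++ zero w = refl
evalT-replicate0-++ (suc j) w = trans (evalT-0∷ (replicate j 0 ++ w)) (evalT-replicate0-++ j w)

evalT-∷ʳ : ∀ w d → evalT (w ∷ʳ d) ≡ d + evalT (w ∷ʳ 0)
evalT-∷ʳ w d rewrite reverse-++ w [ d ] | reverse-++ w [ 0 ] = cong (_+ _) (*-identityʳ d)

-- U_0 = 0, and the sum telescopes since U_{i+1} + T_{i+3} = T_{i+4}.
evalU-∷ʳ+evalT : ∀ w d → evalU (w ∷ʳ d) + evalT w ≡ evalT (w ∷ʳ 0)
evalU-∷ʳ+evalT w d rewrite reverse-++ w [ d ] | reverse-++ w [ 0 ] | *-zeroʳ d =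
  evalRev-telescope Ucoef-suc+Trib 0 (reverse w)

evalT-∷ʳ1 : ∀ a → evalT (a ∷ʳ 1) ≡ 1 + evalU (a ∷ʳ 1) + evalT a
evalT-∷ʳ1 a = trans (evalT-∷ʳ a 1) (cong suc (sym (evalU-∷ʳ+evalT a 1)))

evalT-∷ʳ0-≤ : ∀ w d → evalT (w ∷ʳ 0) ≤ evalT (w ∷ʳ d)
evalT-∷ʳ0-≤ w d = subst (evalT (w ∷ʳ 0) ≤_) (sym (evalT-∷ʳ w d)) (m≤n+m _ d)

evalT-≤-∷ʳ : ∀ w d → evalT w ≤ evalT (w ∷ʳ d)
evalT-≤-∷ʳ w d = begin
  evalT w                     ≤⟨ m≤n+m _ (evalU (w ∷ʳ 0)) ⟩
  evalU (w ∷ʳ 0) + evalT w    ≡⟨ evalU-∷ʳ+evalT w 0 ⟩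
  evalT (w ∷ʳ 0)              ≤⟨ evalT-∷ʳ0-≤ w d ⟩
  evalT (w ∷ʳ d)              ∎
  where open ≤-Reasoning

Binary : ℕ → Set
Binary d = d ≡ 0 ⊎ d ≡ 1

data Canon : Word → Set where
  []      : Canon []
  0∷_     : ∀ {w} → Canon w → Canon (0 ∷ w)
  1∷[]    : Canon (1 ∷ [])
  1∷0∷_   : ∀ {w} → Canon w → Canon (1 ∷ 0 ∷ w)
  1∷1∷[]  : Canon (1 ∷ 1 ∷ [])
  1∷1∷0∷_ : ∀ {w} → Canon w → Canon (1 ∷ 1 ∷ 0 ∷ w)

Canon-head : ∀ {d w} → Canon (d ∷ w) → Binary d
Canon-head (0∷ _)     = inj₁ refl
Canon-head 1∷[]       = inj₂ refl
Canon-head (1∷0∷ _)   = inj₂ refl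
Canon-head 1∷1∷[]     = inj₂ refl
Canon-head (1∷1∷0∷ _) = inj₂ refl

Canon-tail : ∀ {d w} → Canon (d ∷ w) → Canon w
Canon-tail (0∷ c)     = c
Canon-tail 1∷[]       = []
Canon-tail (1∷0∷ c)   = 0∷ c
Canon-tail 1∷1∷[]     = 1∷[]
Canon-tail (1∷1∷0∷ c) = 1∷0∷ c

Canon-++⁻ʳ : ∀ u {v} → Canon (u ++ v) → Canon v
Canon-++⁻ʳ []      c = c
Canon-++⁻ʳ (_ ∷ u) c = Canon-++⁻ʳ u (Canon-tail c)

Canon-++⁻ˡ : ∀ u {v} → Canon (u ++ v) → Canon u
Canon-++⁻ˡ []                  _            = []
Canon-++⁻ˡ (0 ∷ u)             (0∷ c)       = 0∷ Canon-++⁻ˡ u c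
Canon-++⁻ˡ (1 ∷ [])            _            = 1∷[]
Canon-++⁻ˡ (1 ∷ 0 ∷ u)         (1∷0∷ c)     = 1∷0∷ Canon-++⁻ˡ u c
Canon-++⁻ˡ (1 ∷ 1 ∷ [])        _            = 1∷1∷[]
Canon-++⁻ˡ (1 ∷ 1 ∷ 0 ∷ u)     (1∷1∷0∷ c)   = 1∷1∷0∷ Canon-++⁻ˡ u c
Canon-++⁻ˡ (1 ∷ 1 ∷ 1 ∷ _)     ()
Canon-++⁻ˡ (1 ∷ 1 ∷ suc (suc _) ∷ _) ()
Canon-++⁻ˡ (1 ∷ suc (suc _) ∷ _) ()
Canon-++⁻ˡ (suc (suc _) ∷ _)   ()

Canon-last : ∀ w {d} → Canon (w ∷ʳ d) → Binary d
Canon-last w c = Canon-head (Canon-++⁻ʳ w c)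

Canon-∷ʳ0 : ∀ {w} → Canon w → Canon (w ∷ʳ 0)
Canon-∷ʳ0 []         = 0∷ []
Canon-∷ʳ0 (0∷ c)     = 0∷ Canon-∷ʳ0 c
Canon-∷ʳ0 1∷[]       = 1∷0∷ []
Canon-∷ʳ0 (1∷0∷ c)   = 1∷0∷ Canon-∷ʳ0 c
Canon-∷ʳ0 1∷1∷[]     = 1∷1∷0∷ []
Canon-∷ʳ0 (1∷1∷0∷ c) = 1∷1∷0∷ Canon-∷ʳ0 c

Canon-replicate0-++ : ∀ j {w} → Canon w → Canon (replicate j 0 ++ w)
Canon-replicate0-++ zero    c = c
Canon-replicate0-++ (suc j) c = 0∷ Canon-replicate0-++ j c

Canon⇒Canonical : ∀ {w} → Canon w → Canonical w
Canon⇒Canonical {w} c = binary c , λ (u , v , w≡u111v) → no-111 (Canon-++⁻ʳ u (subst Canon w≡u111v c))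
  where
  binary : ∀ {w} → Canon w → All Binary w
  binary []         = []
  binary (0∷ c)     = inj₁ refl ∷ binary c
  binary 1∷[]       = inj₂ refl ∷ []
  binary (1∷0∷ c)   = inj₂ refl ∷ inj₁ refl ∷ binary c
  binary 1∷1∷[]     = inj₂ refl ∷ inj₂ refl ∷ []
  binary (1∷1∷0∷ c) = inj₂ refl ∷ inj₂ refl ∷ inj₁ refl ∷ binary c
  no-111 : ∀ {v} → ¬ Canon (1 ∷ 1 ∷ 1 ∷ v)
  no-111 ()

Contains111 : Word → Set
Contains111 w = Σ Word λ u → Σ Word λ v → w ≡ u ++ (1 ∷ 1 ∷ 1 ∷ []) ++ v

Contains111-∷ : ∀ d {w} → Contains111 w → Contains111 (d ∷ w)
Contains111-∷ d (u , v , eq) = d ∷ u , v , cong (d ∷_) eq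

Canonical⇒Canon : ∀ {w} → Canonical w → Canon w
Canonical⇒Canon ([] , _) = []
Canonical⇒Canon (inj₁ refl ∷ bs , no111) = 0∷ Canonical⇒Canon (bs , no111 ∘ Contains111-∷ 0)
Canonical⇒Canon (inj₂ refl ∷ [] , _) = 1∷[]
Canonical⇒Canon (inj₂ refl ∷ inj₁ refl ∷ bs , no111) =
  1∷0∷ Canonical⇒Canon (bs , no111 ∘ Contains111-∷ 1 ∘ Contains111-∷ 0)
Canonical⇒Canon (inj₂ refl ∷ inj₂ refl ∷ [] , _) = 1∷1∷[]
Canonical⇒Canon (inj₂ refl ∷ inj₂ refl ∷ inj₁ refl ∷ bs , no111) =
  1∷1∷0∷ Canonical⇒Canon (bs , no111 ∘ Contains111-∷ 1 ∘ Contains111-∷ 1 ∘ Contains111-∷ 0)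
Canonical⇒Canon {1 ∷ 1 ∷ 1 ∷ w} (inj₂ refl ∷ inj₂ refl ∷ inj₂ refl ∷ _ , no111) = ⊥-elim (no111 ([] , w , refl))

length-∷ʳ : ∀ (w : Word) d → length (w ∷ʳ d) ≡ suc (length w)
length-∷ʳ w d = trans (length-++ w) (+-comm (length w) 1)

length-∷ʳ-cong : ∀ w v d e → length w ≡ length v → length (w ∷ʳ d) ≡ length (v ∷ʳ e)
length-∷ʳ-cong w v d e len = trans (length-∷ʳ w d) (trans (cong suc len) (sym (length-∷ʳ v e)))

evalT-<-weight : ∀ {w} → Canon w → evalT w < weight (length w)
evalT-<-weight [] = s≤s z≤n
evalT-<-weight (0∷_ {w} c) =
  subst (_< weight (suc (length w))) (sym (evalT-0∷ w)) (≤-trans (evalT-<-weight c) (weight-mono-≤ (n≤1+n (length w))))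
evalT-<-weight 1∷[] = s≤s (s≤s z≤n)
evalT-<-weight (1∷0∷_ {w} c) =
  subst (_< weight (2 + length w)) (sym (evalT-10∷ w))
    (≤-trans (+-monoʳ-< (weight (1 + length w)) (evalT-<-weight c)) (m≤m+n _ _))
evalT-<-weight 1∷1∷[] = s≤s (s≤s (s≤s (s≤s z≤n)))
evalT-<-weight (1∷1∷0∷_ {w} c) =
  subst (_< weight (3 + length w)) (sym (evalT-110∷ w))
    (+-monoʳ-< (weight (2 + length w) + weight (1 + length w)) (evalT-<-weight c))

evalT-0∷<1∷ : ∀ w v → length w ≡ length v → Canon w → evalT (0 ∷ w) < evalT (1 ∷ v)
evalT-0∷<1∷ w v len c = begin-strict
  evalT (0 ∷ w)              ≡⟨ evalT-0∷ w ⟩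
  evalT w                    <⟨ evalT-<-weight c ⟩
  weight (length w)          ≡⟨ cong weight len ⟩
  weight (length v)          ≤⟨ m≤m+n _ (evalT v) ⟩
  weight (length v) + evalT v ≡⟨ evalT-1∷ v ⟨
  evalT (1 ∷ v)              ∎
  where open ≤-Reasoning

∷-evalT-split : ∀ d w v → length w ≡ length v →
  Σ ℕ λ c → evalT (d ∷ w) ≡ c + evalT w × evalT (d ∷ v) ≡ c + evalT v
∷-evalT-split d w v len =
  d * weight (length w) , evalT-∷ d w , trans (evalT-∷ d v) (cong (λ n → d * weight n + evalT v) (sym len))

∷-evalT-injective : ∀ d w v → length w ≡ length v → evalT (d ∷ w) ≡ evalT (d ∷ v) → evalT w ≡ evalT v
∷-evalT-injective d w v len eq with ∷-evalT-split d w v len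
... | c , ew , ev = +-cancelˡ-≡ c _ _ (trans (sym ew) (trans eq ev))

∷-evalT-mono-< : ∀ d w v → length w ≡ length v → evalT w < evalT v → evalT (d ∷ w) < evalT (d ∷ v)
∷-evalT-mono-< d w v len lt with ∷-evalT-split d w v len
... | c , ew , ev = subst₂ _<_ (sym ew) (sym ev) (+-monoʳ-< c lt)

∷-evalT-cancel-< : ∀ d w v → length w ≡ length v → evalT (d ∷ w) < evalT (d ∷ v) → evalT w < evalT v
∷-evalT-cancel-< d w v len lt with ∷-evalT-split d w v len
... | c , ew , ev = +-cancelˡ-< c _ _ (subst₂ _<_ ew ev lt)

Canon-evalT-injective : ∀ {w v} → length w ≡ length v → Canon w → Canon v → evalT w ≡ evalT v → w ≡ v
Canon-evalT-injective {[]} {[]} _ _ _ _ = refl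
Canon-evalT-injective {x ∷ w} {y ∷ v} len cw cv eq with Canon-head cw | Canon-head cv | suc-injective len
... | inj₁ refl | inj₂ refl | len′ = ⊥-elim (<⇒≢ (evalT-0∷<1∷ w v len′ (Canon-tail cw)) eq)
... | inj₂ refl | inj₁ refl | len′ = ⊥-elim (<⇒≢ (evalT-0∷<1∷ v w (sym len′) (Canon-tail cv)) (sym eq))
... | inj₁ refl | inj₁ refl | len′ =
  cong (0 ∷_) (Canon-evalT-injective len′ (Canon-tail cw) (Canon-tail cv) (∷-evalT-injective 0 w v len′ eq))
... | inj₂ refl | inj₂ refl | len′ =
  cong (1 ∷_) (Canon-evalT-injective len′ (Canon-tail cw) (Canon-tail cv) (∷-evalT-injective 1 w v len′ eq))

∷ʳ-evalT-mono-< : ∀ {w v d e} → length w ≡ length v → Canon (w ∷ʳ d) → Canon (v ∷ʳ e) →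
  evalT w < evalT v → evalT (w ∷ʳ d) < evalT (v ∷ʳ e)
∷ʳ-evalT-mono-< {[]} {[]} _ _ _ ()
∷ʳ-evalT-mono-< {x ∷ w} {y ∷ v} {d} {e} len cw cv lt with Canon-head cw | Canon-head cv | suc-injective len
... | inj₁ refl | inj₂ refl | len′ = evalT-0∷<1∷ (w ∷ʳ d) (v ∷ʳ e) (length-∷ʳ-cong w v d e len′) (Canon-tail cw)
... | inj₂ refl | inj₁ refl | len′ = ⊥-elim (<-asym lt (evalT-0∷<1∷ v w (sym len′) (Canon-++⁻ˡ v (Canon-tail cv))))
... | inj₁ refl | inj₁ refl | len′ = ∷-evalT-mono-< 0 (w ∷ʳ d) (v ∷ʳ e) (length-∷ʳ-cong w v d e len′)
  (∷ʳ-evalT-mono-< len′ (Canon-tail cw) (Canon-tail cv) (∷-evalT-cancel-< 0 w v len′ lt))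
... | inj₂ refl | inj₂ refl | len′ = ∷-evalT-mono-< 1 (w ∷ʳ d) (v ∷ʳ e) (length-∷ʳ-cong w v d e len′)
  (∷ʳ-evalT-mono-< len′ (Canon-tail cw) (Canon-tail cv) (∷-evalT-cancel-< 1 w v len′ lt))

Representation : ℕ → ℕ → Set
Representation k n = Σ Word λ w → length w ≡ k × Canon w × evalT w ≡ n

Representation-0∷ : ∀ {k n} → Representation k n → Representation (suc k) n
Representation-0∷ (w , refl , c , refl) = 0 ∷ w , refl , 0∷ c , evalT-0∷ w

Representation-10∷ : ∀ {k m n} → Representation k m → weight (suc k) + m ≡ n → Representation (2 + k) n
Representation-10∷ (w , refl , c , refl) refl = 1 ∷ 0 ∷ w , refl , 1∷0∷ c , evalT-10∷ w

Representation-110∷ : ∀ {k m n} → Representation k m → weight (2 + k) + weight (1 + k) + m ≡ n →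
  Representation (3 + k) n
Representation-110∷ (w , refl , c , refl) refl = 1 ∷ 1 ∷ 0 ∷ w , refl , 1∷1∷0∷ c , evalT-110∷ w

∸-<-of-<+ : ∀ {x a y} → a ≤ x → x < a + y → x ∸ a < y
∸-<-of-<+ {x} {a} {y} a≤x x<a+y = +-cancelˡ-< a (x ∸ a) y (subst (_< a + y) (sym (m+[n∸m]≡n a≤x)) x<a+y)

-- The greedy step: the leading block is 0, 10 or 110 according to where n falls
-- in weight (3 + j) = weight (2 + j) + weight (1 + j) + weight j.
represent-greedy : ∀ j n → n < weight (3 + j) →
  (∀ m → m < weight (2 + j) → Representation (2 + j) m) →
  (∀ m → m < weight (1 + j) → Representation (1 + j) m) →
  (∀ m → m < weight j → Representation j m) →
  Representation (3 + j) n
represent-greedy j n n<w rep₂ rep₁ rep₀ with n <? weight (2 + j)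
... | yes n<w₂ = Representation-0∷ (rep₂ n n<w₂)
... | no n≮w₂ with n ∸ weight (2 + j) <? weight (1 + j)
...   | yes r<w₁ = Representation-10∷ (rep₁ _ r<w₁) (m+[n∸m]≡n (≮⇒≥ n≮w₂))
...   | no r≮w₁ = Representation-110∷ (rep₀ _ r′<w) sum≡n
  where
  r = n ∸ weight (2 + j)
  r′<w : r ∸ weight (1 + j) < weight j
  r′<w = ∸-<-of-<+ (≮⇒≥ r≮w₁) (∸-<-of-<+ (≮⇒≥ n≮w₂) (subst (n <_) (+-assoc (weight (2 + j)) _ _) n<w))
  sum≡n : weight (2 + j) + weight (1 + j) + (r ∸ weight (1 + j)) ≡ n
  sum≡n = trans (+-assoc (weight (2 + j)) _ _)
                (trans (cong (weight (2 + j) +_) (m+[n∸m]≡n (≮⇒≥ r≮w₁))) (m+[n∸m]≡n (≮⇒≥ n≮w₂)))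

represent : ∀ k n → n < weight k → Representation k n
represent 0 0 _ = [] , refl , [] , refl
represent 0 (suc _) (s≤s ())
represent 1 0 _ = 0 ∷ [] , refl , 0∷ [] , refl
represent 1 1 _ = 1 ∷ [] , refl , 1∷[] , refl
represent 1 (suc (suc _)) (s≤s (s≤s ()))
represent 2 0 _ = 0 ∷ 0 ∷ [] , refl , 0∷ 0∷ [] , refl
represent 2 1 _ = 0 ∷ 1 ∷ [] , refl , 0∷ 1∷[] , refl
represent 2 2 _ = 1 ∷ 0 ∷ [] , refl , 1∷0∷ [] , refl
represent 2 3 _ = 1 ∷ 1 ∷ [] , refl , 1∷1∷[] , refl
represent 2 (suc (suc (suc (suc _)))) (s≤s (s≤s (s≤s (s≤s ()))))
represent (suc (suc (suc j))) n n<w =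
  represent-greedy j n n<w (represent (suc (suc j))) (represent (suc j)) (represent j)

Prefix : ℕ → ℕ → Word → Set
Prefix k n v = Σ ℕ λ d → length v ≡ k × Canon (v ∷ʳ d) × evalT (v ∷ʳ d) ≡ n

prefix-exists : ∀ k n → n < weight (suc k) → ∃ (Prefix k n)
prefix-exists k n n<w with represent (suc k) n n<w
... | w , len , c , e with initLast w
...   | v ∷ʳ′ d = v , d , suc-injective (trans (sym (length-∷ʳ v d)) len) , c , e
...   | []     with () ← len

Prefix-unique : ∀ {k n v v′} → Prefix k n v → Prefix k n v′ → v ≡ v′
Prefix-unique {v = v} {v′} (d , len , c , e) (d′ , len′ , c′ , e′) =
  ∷ʳ-injectiveˡ v v′
    (Canon-evalT-injective (length-∷ʳ-cong v v′ d d′ (trans len (sym len′))) c c′ (trans e (sym e′)))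

Canon-last-unique-≤ : ∀ w v {d e} → length w ≤ length v → Canon (w ∷ʳ d) → Canon (v ∷ʳ e) →
  evalT (w ∷ʳ d) ≡ evalT (v ∷ʳ e) → d ≡ e
Canon-last-unique-≤ w v {d} {e} w≤v cw cv eq =
  ∷ʳ-injectiveʳ padded v (Canon-evalT-injective (length-∷ʳ-cong padded v d e |padded|≡|v|) c-padded cv eq-padded)
  where
  j = length v ∸ length w
  padded = replicate j 0 ++ w
  assoc : padded ∷ʳ d ≡ replicate j 0 ++ (w ∷ʳ d)
  assoc = ++-assoc (replicate j 0) w [ d ]
  |padded|≡|v| : length padded ≡ length v
  |padded|≡|v| = trans (length-++ (replicate j 0)) (trans (cong (_+ length w) (length-replicate j)) (m∸n+n≡m w≤v))
  c-padded : Canon (padded ∷ʳ d)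
  c-padded = subst Canon (sym assoc) (Canon-replicate0-++ j cw)
  eq-padded : evalT (padded ∷ʳ d) ≡ evalT (v ∷ʳ e)
  eq-padded = trans (cong evalT assoc) (trans (evalT-replicate0-++ j (w ∷ʳ d)) eq)

Canon-last-unique : ∀ w v {d e} → Canon (w ∷ʳ d) → Canon (v ∷ʳ e) → evalT (w ∷ʳ d) ≡ evalT (v ∷ʳ e) → d ≡ e
Canon-last-unique w v cw cv eq with ≤-total (length w) (length v)
... | inj₁ w≤v = Canon-last-unique-≤ w v w≤v cw cv eq
... | inj₂ v≤w = sym (Canon-last-unique-≤ v w v≤w cv cw (sym eq))

∷ʳ0-evalT-cancel-< : ∀ u v {d} → length u ≡ length v → Canon (u ∷ʳ 0) → Canon (v ∷ʳ d) →
  evalT (v ∷ʳ d) < evalT (u ∷ʳ 0) → evalT v < evalT u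
∷ʳ0-evalT-cancel-< u v {d} len cu cv lt with <-cmp (evalT v) (evalT u)
... | tri< v<u _ _ = v<u
... | tri≈ _ v≡u _ = ⊥-elim (<⇒≱ lt u0≤vd)
  where
  u≡v : u ≡ v
  u≡v = Canon-evalT-injective len (Canon-++⁻ˡ u cu) (Canon-++⁻ˡ v cv) (sym v≡u)
  u0≤vd : evalT (u ∷ʳ 0) ≤ evalT (v ∷ʳ d)
  u0≤vd = subst (λ x → evalT (x ∷ʳ 0) ≤ evalT (v ∷ʳ d)) (sym u≡v) (evalT-∷ʳ0-≤ v d)
... | tri> _ _ u<v = ⊥-elim (<-asym lt (∷ʳ-evalT-mono-< len cu cv u<v))

∷ʳ0-evalT-no-gap : ∀ u v {d} → length u ≡ length v → Canon (u ∷ʳ 0) → Canon (v ∷ʳ d) →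
  evalT (u ∷ʳ 0) ≡ suc (evalT (v ∷ʳ d)) → evalT u ≤ suc (evalT v)
∷ʳ0-evalT-no-gap u v {d} len cu cv eq = ≮⇒≥ gap
  where
  gap : suc (evalT v) < evalT u → ⊥
  gap lt with represent (length u) (suc (evalT v)) (<-trans lt (evalT-<-weight (Canon-++⁻ˡ u cu)))
  ... | w , lw , cw , ew = <⇒≱ vd<w0 (≤-pred (subst (evalT (w ∷ʳ 0) <_) eq w0<u0))
    where
    vd<w0 : evalT (v ∷ʳ d) < evalT (w ∷ʳ 0)
    vd<w0 = ∷ʳ-evalT-mono-< (trans (sym len) (sym lw)) cv (Canon-∷ʳ0 cw) (subst (evalT v <_) (sym ew) (n<1+n _))
    w0<u0 : evalT (w ∷ʳ 0) < evalT (u ∷ʳ 0)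
    w0<u0 = ∷ʳ-evalT-mono-< lw (Canon-∷ʳ0 cw) cu (subst (_< evalT u) (sym ew) lt)

evalT-prefix-suc : ∀ u v {d e} → length u ≡ length v → Canon (u ∷ʳ e) → Canon (v ∷ʳ d) →
  evalT (u ∷ʳ e) ≡ suc (evalT (v ∷ʳ d)) →
  (e ≡ 1 × evalT u ≡ evalT v) ⊎ (e ≡ 0 × evalT u ≡ suc (evalT v))
evalT-prefix-suc u v {d} len cu cv eq with Canon-last u cu
... | inj₂ refl = inj₁ (refl , cong evalT u≡v)
  where
  u≡v : u ≡ v
  u≡v = ∷ʳ-injectiveˡ u v (Canon-evalT-injective (length-∷ʳ-cong u v 0 d len) (Canon-∷ʳ0 (Canon-++⁻ˡ u cu)) cv
          (suc-injective (trans (sym (evalT-∷ʳ u 1)) eq)))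
... | inj₁ refl = inj₂ (refl , ≤-antisym (∷ʳ0-evalT-no-gap u v len cu cv eq) (∷ʳ0-evalT-cancel-< u v len cu cv vd<u0))
  where
  vd<u0 : evalT (v ∷ʳ d) < evalT (u ∷ʳ 0)
  vd<u0 = subst (evalT (v ∷ʳ d) <_) (sym eq) (n<1+n _)

Linked-∷ʳ : ∀ {A : Set} {R : A → A → Set} {xs x} → Linked R xs → All (λ y → R y x) xs → Linked R (xs ∷ʳ x)
Linked-∷ʳ []      []       = [-]
Linked-∷ʳ [-]     (r ∷ []) = r ∷ [-]
Linked-∷ʳ (r ∷ l) (_ ∷ rs) = r ∷ Linked-∷ʳ l rs

Linked-<⇒Unique : ∀ {xs} → Linked _<_ xs → Unique xs
Linked-<⇒Unique sorted = AllPairs.map <⇒≢ (Linked⇒AllPairs <-trans sorted)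

Enumerates : (ℕ → Set) → ℕ → List ℕ → Set
Enumerates P n xs = Linked _<_ xs × (∀ m → (m ∈ xs) ⇔ (1 ≤ m × m ≤ n × P m))

module _ {P : ℕ → Set} where

  Enumerates-zero : Enumerates P 0 []
  Enumerates-zero = [] , λ m → mk⇔ (λ ()) (λ { (s≤s _ , () , _) })

  Enumerates-suc-∈ : ∀ {n xs} → Enumerates P n xs → P (suc n) → Enumerates P (suc n) (xs ∷ʳ suc n)
  Enumerates-suc-∈ {n} {xs} (sorted , members) p =
    Linked-∷ʳ sorted (All.tabulate below) , λ m → mk⇔ (to m) (from m)
    where
    below : ∀ {m} → m ∈ xs → m < suc n
    below {m} m∈xs = s≤s (proj₁ (proj₂ (Equivalence.to (members m) m∈xs)))
    to : ∀ m → m ∈ xs ∷ʳ suc n → 1 ≤ m × m ≤ suc n × P m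
    to m m∈ with ∈-++⁻ xs m∈
    ... | inj₁ m∈xs with Equivalence.to (members m) m∈xs
    ...   | 1≤m , m≤n , pm = 1≤m , m≤n⇒m≤1+n m≤n , pm
    to m m∈ | inj₂ (here refl) = s≤s z≤n , ≤-refl , p
    from : ∀ m → 1 ≤ m × m ≤ suc n × P m → m ∈ xs ∷ʳ suc n
    from m (1≤m , m≤1+n , pm) with m≤n⇒m<n∨m≡n m≤1+n
    ... | inj₁ (s≤s m≤n) = ∈-++⁺ˡ (Equivalence.from (members m) (1≤m , m≤n , pm))
    ... | inj₂ refl = ∈-++⁺ʳ xs (here refl)

  Enumerates-suc-∉ : ∀ {n xs} → Enumerates P n xs → ¬ P (suc n) → Enumerates P (suc n) xs
  Enumerates-suc-∉ {n} {xs} (sorted , members) ¬p = sorted , λ m → mk⇔ (to m) (from m)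
    where
    to : ∀ m → m ∈ xs → 1 ≤ m × m ≤ suc n × P m
    to m m∈xs with Equivalence.to (members m) m∈xs
    ... | 1≤m , m≤n , pm = 1≤m , m≤n⇒m≤1+n m≤n , pm
    from : ∀ m → 1 ≤ m × m ≤ suc n × P m → m ∈ xs
    from m (1≤m , m≤1+n , pm) with m≤n⇒m<n∨m≡n m≤1+n
    ... | inj₁ (s≤s m≤n) = Equivalence.from (members m) (1≤m , m≤n , pm)
    ... | inj₂ refl = ⊥-elim (¬p pm)

  Enumerates-length : ∀ {n xs ys} → Enumerates P n xs → Enumerates P n ys → length xs ≡ length ys
  Enumerates-length (sx , mx) (sy , my) =
    ↭-length (∼bag⇒↭ (unique∧set⇒bag (Linked-<⇒Unique sx) (Linked-<⇒Unique sy)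
      λ {m} → ⇔.trans (mx m) (⇔.sym (my m))))

enumerate : ∀ k n → n < weight (suc k) →
  Σ (List ℕ) λ xs → Enumerates EndsIn1 n xs × (∀ {v} → Prefix k n v → length xs + evalT v ≡ n)
enumerate k zero _ =
  [] , Enumerates-zero , λ {v} (d , _ , _ , e) → n≤0⇒n≡0 (subst (evalT v ≤_) e (evalT-≤-∷ʳ v d))
enumerate k (suc n) n+1<w
  with enumerate k n (<-trans (n<1+n n) n+1<w) | prefix-exists k n (<-trans (n<1+n n) n+1<w)
     | prefix-exists k (suc n) n+1<w
... | xs , enum , count | v , d , lv , cv , ev | u , e , lu , cu , eu
  with evalT-prefix-suc u v (trans lu (sym lv)) cu cv (trans eu (cong suc (sym ev)))
... | inj₁ (refl , [u]≡[v]) = xs ∷ʳ suc n , Enumerates-suc-∈ enum (u , Canon⇒Canonical cu , eu) , count′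
  where
  count′ : ∀ {v′} → Prefix k (suc n) v′ → length (xs ∷ʳ suc n) + evalT v′ ≡ suc n
  count′ p rewrite Prefix-unique p (1 , lu , cu , eu) | length-∷ʳ xs (suc n) | [u]≡[v] =
    cong suc (count (d , lv , cv , ev))
... | inj₂ (refl , [u]≡1+[v]) = xs , Enumerates-suc-∉ enum ¬ends-in-1 , count′
  where
  ¬ends-in-1 : ¬ EndsIn1 (suc n)
  ¬ends-in-1 (a , can , ea) with Canon-last-unique a u (Canonical⇒Canon can) cu (trans ea (sym eu))
  ... | ()
  count′ : ∀ {v′} → Prefix k (suc n) v′ → length xs + evalT v′ ≡ suc n
  count′ p rewrite Prefix-unique p (0 , lu , cu , eu) | [u]≡1+[v] =
    trans (+-suc (length xs) (evalT v)) (cong suc (count (d , lv , cv , ev)))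

mainTheorem6 : (a : List ℕ) → Canonical (a ++ [ 1 ]) →
    TrithoffFirst (1 + evalU (a ++ [ 1 ])) (evalT (a ++ [ 1 ]))
    × (∀ r → TrithoffFirst r (evalT (a ++ [ 1 ])) → r ≡ 1 + evalU (a ++ [ 1 ]))
    × (evalT (a ++ [ 1 ]) ∸ evalT a ≡ 1 + evalU (a ++ [ 1 ]))
mainTheorem6 a canon with enumerate (length a) (evalT (a ∷ʳ 1)) a1<w
  where
  a1<w : evalT (a ∷ʳ 1) < weight (suc (length a))
  a1<w = subst (λ k → evalT (a ∷ʳ 1) < weight k) (length-∷ʳ a 1) (evalT-<-weight (Canonical⇒Canon canon))
... | xs , enum , count =
  ((a , canon , refl) , 1≤[a1] , xs , proj₁ enum , |xs|≡1+[a1]U , proj₂ enum) ,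
  (λ { r (_ , _ , ys , sorted , |ys|≡r , members) →
       trans (sym |ys|≡r) (trans (Enumerates-length (sorted , members) enum) |xs|≡1+[a1]U) }) ,
  trans (cong (_∸ evalT a) (evalT-∷ʳ1 a)) (m+n∸n≡m _ (evalT a))
  where
  1≤[a1] : 1 ≤ evalT (a ∷ʳ 1)
  1≤[a1] = subst (1 ≤_) (sym (evalT-∷ʳ a 1)) (s≤s z≤n)
  |xs|≡1+[a1]U : length xs ≡ 1 + evalU (a ∷ʳ 1)
  |xs|≡1+[a1]U = +-cancelʳ-≡ (evalT a) _ _ (trans (count (1 , refl , Canonical⇒Canon canon , refl)) (evalT-∷ʳ1 a))
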